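{- Let $\mathcal{M}_1,\mathcal{M}_2$ be matroids on a common ground set $V$ (accessible via independence oracles), let $S$ be a common independent set with $|S|=r$, let $h\ge 1$ be an integer, and let $F$ be a set of vertices of the exchange graph $G(S)$, with $F_S=F\cap S$ and $F_{\bar S}=F\cap\bar S$, such that $G(S)$ has no edges from $F_{\bar S}$ to $S\setminus F_S$. There is an algorithm which, given $F$, the partition of $\bar S\setminus F_{\bar S}$ into heavy and light vertices, and all out-edges of the light vertices to $S\setminus F_S$, uses $O(n\log r)$ independence queries and either finds a path in $G(S)$ from some vertex in $F$ to a heavy vertex, or otherwise determines that no such path exists.
   Context: A matroid $\mathcal{M}=(V,\mathcal{I})$ consists of a finite ground set $V$ and a nonempty, downward closed family $\mathcal{I}\subseteq 2^V$ of independent sets satisfying the exchange property; $|V|=n$. An independence oracle for $\mathcal{M}_i$ answers, for $X\subseteq V$, whether $X\in\mathcal{I}_i$; cost is the number of queries. For a common independent set $S\in\mathcal{I}_1\cap\mathcal{I}_2$, the exchange graph $G(S)$ is the directed graph on $V\cup\{s,t\}$, bipartite between $S$ and $\bar S=V\setminus S$, with edges: $(s,v)$ for $v\in\bar S$ iff $S\cup\{v\}\in\mathcal{I}_1$; $(v,t)$ for $v\in\bar S$ iff $S\cup\{v\}\in\mathcal{I}_2$; $(u,v)$ for $u\in S,v\in\bar S$ iff $(S\setminus\{u\})\cup\{v\}\in\mathcal{I}_1$; $(v,u)$ for $v\in\bar S,u\in S$ iff $(S\setminus\{u\})\cup\{v\}\in\mathcal{I}_2$. Given the set $F$ and parameter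 $h$, a vertex $v\in\bar S\setminus F_{\bar S}$ is called heavy if either $(v,t)$ is an edge of $G(S)$ or $v$ has at least $h$ out-neighbors in $S\setminus F_S$; otherwise $v$ is called light. -}

module Defs where

open import Data.Nat using (ℕ; zero; suc; _+_; _*_; _≤_; _<_)
open import Data.Bool using (Bool; true; false; _∧_; not)
open import Data.Fin using (Fin)
open import Data.Fin.Subset using (Subset; _∈_; _∉_; _⊆_; _∪_; _─_; _-_; ⁅_⁆; ∣_∣; ⊥)
open import Data.Vec using (lookup; tabulate)
open import Data.List using (List; []; _∷_)
open import Data.Maybe using (Maybe; just; nothing)
open import Data.Product using (_×_; _,_; Σ; ∃; ∃-syntax)
open import Data.Sum using (_⊎_)
open import Relation.Binary.PropositionalEquality using (_≡_)
open import Relation.Nullary using (¬_)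

record Matroid (n : ℕ) : Set where
  field
    indep       : Subset n → Bool
    indep-empty : indep ⊥ ≡ true
    indep-down  : ∀ {A B} → A ⊆ B → indep B ≡ true → indep A ≡ true
    indep-exch  : ∀ {A B} → indep A ≡ true → indep B ≡ true → ∣ A ∣ < ∣ B ∣ →
                  ∃[ x ] (x ∈ B × x ∉ A × indep (A ∪ ⁅ x ⁆) ≡ true)
open Matroid public

Indep : ∀ {n} → Matroid n → Subset n → Set
Indep M X = indep M X ≡ true

-- Exchange graph G(S), restricted to edges among vertices of V
-- (edges from s and into t are given separately).

module _ {n : ℕ} (M₁ M₂ : Matroid n) (S : Subset n) where

  SEdge : Fin n → Set
  SEdge v = v ∉ S × Indep M₁ (S ∪ ⁅ v ⁆)

  TEdge : Fin n → Set
  TEdge v = v ∉ S × Indep M₂ (S ∪ ⁅ v ⁆)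

  Edge : Fin n → Fin n → Set
  Edge x y = (x ∈ S × y ∉ S × Indep M₁ ((S - x) ∪ ⁅ y ⁆))
           ⊎ (x ∉ S × y ∈ S × Indep M₂ ((S - y) ∪ ⁅ x ⁆))

  outNbrs : Subset n → Fin n → Subset n
  outNbrs F v = tabulate λ u →
    lookup S u ∧ not (lookup F u) ∧ indep M₂ ((S - u) ∪ ⁅ v ⁆)

  Heavy : Subset n → ℕ → Fin n → Set
  Heavy F h v = v ∉ S × v ∉ F × (TEdge v ⊎ h ≤ ∣ outNbrs F v ∣)

  Light : Subset n → ℕ → Fin n → Set
  Light F h v = v ∉ S × v ∉ F × ¬ TEdge v × ∣ outNbrs F v ∣ < h

  -- a walk x = x₀ , x₁ , … , x_k given as (x , [x₁ … x_k])
  Walk : Fin n → List (Fin n) → Set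
  Walk x []       = Data.Unit.⊤ where import Data.Unit
  Walk x (y ∷ ys) = Edge x y × Walk y ys

  lastV : Fin n → List (Fin n) → Fin n
  lastV x []       = x
  lastV x (y ∷ ys) = lastV y ys

  PathFH : Subset n → ℕ → Fin n → List (Fin n) → Set
  PathFH F h x xs = x ∈ F × Walk x xs × Unique (x ∷ xs) × Heavy F h (lastV x xs)
    where open import Data.List.Relation.Unary.Unique.Propositional using (Unique)

-- Query algorithms (decision trees) against the two independence oracles.
-- A query is (i , X): "is X independent in M_i ?" (false ↦ M₁, true ↦ M₂).

data QAlg (n : ℕ) (A : Set) : Set where
  ret : A → QAlg n A
  ask : Bool → Subset n → (Bool → QAlg n A) → QAlg n A

oracle : ∀ {n} → Matroid n → Matroid n → Bool → Subset n → Bool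
oracle M₁ M₂ false X = indep M₁ X
oracle M₁ M₂ true  X = indep M₂ X

result : ∀ {n A} → Matroid n → Matroid n → QAlg n A → A
result M₁ M₂ (ret a)     = a
result M₁ M₂ (ask i X k) = result M₁ M₂ (k (oracle M₁ M₂ i X))

queries : ∀ {n A} → Matroid n → Matroid n → QAlg n A → ℕ
queries M₁ M₂ (ret a)     = 0
queries M₁ M₂ (ask i X k) = suc (queries M₁ M₂ (k (oracle M₁ M₂ i X)))

module _ {n : ℕ} (M₁ M₂ : Matroid n) (S : Subset n) where

  NoEdgesFbarToS : Subset n → Set
  NoEdgesFbarToS F = ∀ v u → v ∈ F → v ∉ S → u ∈ S → u ∉ F → ¬ Edge M₁ M₂ S v u

  HeavyInput : Subset n → ℕ → Subset n → Set
  HeavyInput F h H = ∀ v → (v ∈ H → Heavy M₁ M₂ S F h v) × (Heavy M₁ M₂ S F h v → v ∈ H)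

  LightInput : Subset n → ℕ → (Fin n → Subset n) → Set
  LightInput F h L = ∀ v → Light M₁ M₂ S F h v → L v ≡ outNbrs M₁ M₂ S F v

  CorrectOutput : Subset n → ℕ → Maybe (Fin n × List (Fin n)) → Set
  CorrectOutput F h (just (x , xs)) = PathFH M₁ M₂ S F h x xs
  CorrectOutput F h nothing = ∀ x xs → ¬ PathFH M₁ M₂ S F h x xs

-- Search G(S) backwards from the heavy vertices, keeping the list U of undiscovered vertices and a
-- queue of discovered vertices, each stored with a simple path to a heavy vertex. An in-neighbour of
-- y ∈ S lies in S̄; it is not heavy (heavy vertices start discovered) and not in F (F_S̄ has no edges
-- into S ∖ F_S), so it is light and is read off the given out-edge lists without any query.
-- The in-neighbours u ∈ S of y ∉ S are the u with (S - u) + y independent in M₁. Since S + y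
-- contains at most one circuit, if (S ∖ B) + y is independent and B = B₁ ∪ B₂, then (S ∖ B₁) + y or
-- (S ∖ B₂) + y is independent; so binary search over the undiscovered part of S finds such a u, or
-- shows there is none, with at most 1 + ⌈log₂ |S|⌉ queries. Every search discovers a vertex or
-- retires y, lowering the potential |queue| + 2|U| ≤ 2n; hence at most 2n(1 + ⌈log₂ |S|⌉) queries.
-- If the search ends without reaching F, the discovered vertices contain the heavy ones, avoid F and
-- are closed under in-edges, so no path leads from F to a heavy vertex.

module Submission where

open import Defs
open import Data.Bool using (Bool; true; false; if_then_else_; _∧_; not)
open import Data.Empty using (⊥-elim)
open import Data.Fin using (Fin; zero; suc)
open import Data.Fin.Properties using (_≟_; any?)
open import Data.Fin.Subset using (Subset; ⋃; _∈_; _∉_; _⊆_; _∪_; _∩_; _─_; _-_; ⁅_⁆; ∣_∣; inside; outside)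
open import Data.Fin.Subset.Properties
  using (_∈?_; ∉⊥; ∪-identityʳ; x∈⁅x⁆; x∈⁅y⁆⇒x≡y; ∣⁅x⁆∣≡1; x∈p∪q⁻; x∈p∪q⁺; p⊆p∪q; x∈p∩q⁻; x∈p∩q⁺;
         x∈p∧x∉q⇒x∈p─q; p─q⊆p; x∈p∧x≢y⇒x∈p-y; x∈p⇒∣p-x∣<∣p∣; p⊂q⇒∣p∣<∣q∣; p⊆q⇒∣p∣≤∣q∣)
open import Data.List using (List; []; _∷_; _++_; length; map; filter; allFin)
open import Data.List.Properties using (length-map; length-filter; length-tabulate; length-++; map-++; filter-some)
open import Data.List.Membership.Propositional using () renaming (_∈_ to _∈ₗ_; _∉_ to _∉ₗ_)
open import Data.List.Membership.Propositional.Properties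
  using (∈-map⁺; ∈-map⁻; ∈-filter⁺; ∈-filter⁻; ∈-allFin; ∈-++⁺ˡ; ∈-++⁺ʳ)
import Data.List.Membership.DecPropositional as DecMembership
open import Data.List.Relation.Unary.All using (All; []; _∷_)
import Data.List.Relation.Unary.All as All
open import Data.List.Relation.Unary.All.Properties using (¬Any⇒All¬; ++⁺; map⁺)
open import Data.List.Relation.Unary.Any using (Any; here; there)
open import Data.List.Relation.Unary.Unique.Propositional using (Unique; []; _∷_)
open import Data.Maybe using (Maybe; just; nothing)
open import Data.Nat using (ℕ; zero; suc; _+_; _*_; _∸_; _≤_; _<_; z≤n; s≤s; ⌊_/2⌋; ⌈_/2⌉)
open import Data.Nat.Properties hiding (_≟_)
open import Data.Nat.Logarithm using (⌈log₂_⌉; ⌈log₂⌉-mono-≤; ⌈log₂⌈n/2⌉⌉≡⌈log₂n⌉∸1; ⌈log₂2^n⌉≡n)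
open import Data.Nat.Tactic.RingSolver using (solve-∀)
open import Data.Product using (_×_; _,_; Σ; ∃-syntax; proj₁; proj₂)
open import Data.Sum using (_⊎_; inj₁; inj₂)
open import Data.Unit using (tt)
open import Data.Vec using (_∷_; [])
import Data.Vec as Vec
open import Data.Vec.Properties using (lookup∘tabulate; []=⇒lookup; lookup⇒[]=)
open import Function using (id; _∘_; case_of_)
open import Relation.Binary.PropositionalEquality
open import Relation.Nullary using (¬_; yes; no; contradiction)
open import Relation.Nullary.Decidable using (_×-dec_; ¬?)
open import Relation.Unary using (Decidable)
open import Relation.Unary.Properties using (∁?)

∣p∪q∣≤∣p∣+∣q∣ : ∀ {n} (p q : Subset n) → ∣ p ∪ q ∣ ≤ ∣ p ∣ + ∣ q ∣
∣p∪q∣≤∣p∣+∣q∣ []            []            = z≤n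
∣p∪q∣≤∣p∣+∣q∣ (outside ∷ p) (outside ∷ q) = ∣p∪q∣≤∣p∣+∣q∣ p q
∣p∪q∣≤∣p∣+∣q∣ (outside ∷ p) (inside  ∷ q) = ≤-trans (s≤s (∣p∪q∣≤∣p∣+∣q∣ p q)) (≤-reflexive (sym (+-suc _ _)))
∣p∪q∣≤∣p∣+∣q∣ (inside  ∷ p) (outside ∷ q) = s≤s (∣p∪q∣≤∣p∣+∣q∣ p q)
∣p∪q∣≤∣p∣+∣q∣ (inside  ∷ p) (inside  ∷ q) = s≤s (≤-trans (∣p∪q∣≤∣p∣+∣q∣ p q) (+-monoʳ-≤ ∣ p ∣ (n≤1+n _)))

x∈p─q⇒x∉q : ∀ {n} {x : Fin n} (p q : Subset n) → x ∈ p ─ q → x ∉ q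
x∈p─q⇒x∉q (inside  ∷ p) (outside ∷ q) Vec.here    ()
x∈p─q⇒x∉q (_       ∷ p) (_       ∷ q) (Vec.there x∈p─q) (Vec.there x∈q) = x∈p─q⇒x∉q p q x∈p─q x∈q

⊆⊎∃∉ : ∀ {n} (p q : Subset n) → p ⊆ q ⊎ ∃[ x ] x ∈ p × x ∉ q
⊆⊎∃∉ p q with any? (λ x → x ∈? p ×-dec ¬? (x ∈? q))
... | yes witness = inj₂ witness
... | no ¬witness = inj₁ λ {x} x∈p → case x ∈? q of λ where
  (yes x∈q) → x∈q
  (no x∉q)  → ⊥-elim (¬witness (x , x∈p , x∉q))

∣p∣+2≤∣q∣ : ∀ {n} {p q : Subset n} {x y} → p ⊆ q → x ∈ q → y ∈ q → x ≢ y → x ∉ p → y ∉ p →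
            2 + ∣ p ∣ ≤ ∣ q ∣
∣p∣+2≤∣q∣ {p = p} {q} {x} {y} p⊆q x∈q y∈q x≢y x∉p y∉p = begin
  2 + ∣ p ∣         ≤⟨ s≤s (s≤s (p⊆q⇒∣p∣≤∣q∣ p⊆q-x-y)) ⟩
  2 + ∣ q - x - y ∣ ≤⟨ s≤s (x∈p⇒∣p-x∣<∣p∣ (x∈p∧x≢y⇒x∈p-y y∈q (x≢y ∘ sym))) ⟩
  1 + ∣ q - x ∣     ≤⟨ x∈p⇒∣p-x∣<∣p∣ x∈q ⟩
  ∣ q ∣             ∎
  where
  open ≤-Reasoning
  p⊆q-x-y : p ⊆ q - x - y
  p⊆q-x-y {z} z∈p = x∈p∧x≢y⇒x∈p-y (x∈p∧x≢y⇒x∈p-y (p⊆q z∈p) (λ { refl → x∉p z∈p })) (λ { refl → y∉p z∈p })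

⟦_⟧ : ∀ {n} → List (Fin n) → Subset n
⟦ B ⟧ = ⋃ (map ⁅_⁆ B)

module _ {n : ℕ} {x : Fin n} where

  ∈⟦⟧⁺ : ∀ {B} → x ∈ₗ B → x ∈ ⟦ B ⟧
  ∈⟦⟧⁺ (here refl) = x∈p∪q⁺ (inj₁ (x∈⁅x⁆ x))
  ∈⟦⟧⁺ (there x∈B) = x∈p∪q⁺ (inj₂ (∈⟦⟧⁺ x∈B))

  ∈⟦⟧⁻ : ∀ B → x ∈ ⟦ B ⟧ → x ∈ₗ B
  ∈⟦⟧⁻ []      x∈⊥ = contradiction x∈⊥ ∉⊥
  ∈⟦⟧⁻ (b ∷ B) x∈  with x∈p∪q⁻ ⁅ b ⁆ ⟦ B ⟧ x∈
  ... | inj₁ x∈b = here (x∈⁅y⁆⇒x≡y b x∈b)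
  ... | inj₂ x∈B = there (∈⟦⟧⁻ B x∈B)

elements : ∀ {n} → Subset n → List (Fin n)
elements []            = []
elements (inside  ∷ p) = zero ∷ map suc (elements p)
elements (outside ∷ p) = map suc (elements p)

length-elements : ∀ {n} (p : Subset n) → length (elements p) ≡ ∣ p ∣
length-elements []            = refl
length-elements (inside  ∷ p) = cong suc (trans (length-map suc (elements p)) (length-elements p))
length-elements (outside ∷ p) = trans (length-map suc (elements p)) (length-elements p)

∈-elements⁺ : ∀ {n} {x : Fin n} {p} → x ∈ p → x ∈ₗ elements p
∈-elements⁺ {p = inside  ∷ p} Vec.here           = here refl
∈-elements⁺ {p = inside  ∷ p} (Vec.there x∈p)    = there (∈-map⁺ suc (∈-elements⁺ x∈p))
∈-elements⁺ {p = outside ∷ p} (Vec.there x∈p)    = ∈-map⁺ suc (∈-elements⁺ x∈p)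

∈-elements⁻ : ∀ {n} {x : Fin n} p → x ∈ₗ elements p → x ∈ p
∈-elements⁻ (inside  ∷ p) (here refl) = Vec.here
∈-elements⁻ (inside  ∷ p) (there x∈)  with ∈-map⁻ suc x∈
... | _ , x∈p , refl = Vec.there (∈-elements⁻ p x∈p)
∈-elements⁻ (outside ∷ p) x∈          with ∈-map⁻ suc x∈
... | _ , x∈p , refl = Vec.there (∈-elements⁻ p x∈p)

length-filter+length-filter-∁ : ∀ {A : Set} {P : A → Set} (P? : Decidable P) xs →
                                length (filter P? xs) + length (filter (∁? P?) xs) ≡ length xs
length-filter+length-filter-∁ P? []       = refl
length-filter+length-filter-∁ P? (x ∷ xs) with P? x
... | yes _ = cong suc (length-filter+length-filter-∁ P? xs)
... | no  _ = trans (+-suc _ _) (cong suc (length-filter+length-filter-∁ P? xs))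

⌈log₂⌉-halve : ∀ n → suc ⌈log₂ ⌈ 2 + n /2⌉ ⌉ ≡ ⌈log₂ (2 + n) ⌉
⌈log₂⌉-halve n = begin
  suc ⌈log₂ ⌈ 2 + n /2⌉ ⌉    ≡⟨ cong suc (⌈log₂⌈n/2⌉⌉≡⌈log₂n⌉∸1 (2 + n)) ⟩
  1 + (⌈log₂ (2 + n) ⌉ ∸ 1)  ≡⟨ m+[n∸m]≡n 1≤log ⟩
  ⌈log₂ (2 + n) ⌉            ∎
  where
  open ≡-Reasoning
  1≤log : 1 ≤ ⌈log₂ (2 + n) ⌉
  1≤log = ≤-trans (≤-reflexive (sym (⌈log₂2^n⌉≡n 1))) (⌈log₂⌉-mono-≤ (s≤s (s≤s (z≤n {n}))))

deal : ∀ {A : Set} → List A → List A × List A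
deal []       = [] , []
deal (x ∷ xs) = x ∷ proj₂ (deal xs) , proj₁ (deal xs)

module _ {A : Set} where

  length-deal₁ : (xs : List A) → length (proj₁ (deal xs)) ≡ ⌈ length xs /2⌉
  length-deal₂ : (xs : List A) → length (proj₂ (deal xs)) ≡ ⌊ length xs /2⌋
  length-deal₁ []       = refl
  length-deal₁ (x ∷ xs) = cong suc (length-deal₂ xs)
  length-deal₂ []       = refl
  length-deal₂ (x ∷ xs) = length-deal₁ xs

  length-deal₁-≤ : (xs : List A) → length (proj₁ (deal xs)) ≤ length xs
  length-deal₁-≤ xs = ≤-trans (≤-reflexive (length-deal₁ xs)) (⌈n/2⌉≤n _)

  length-deal₂-≤ : (xs : List A) → length (proj₂ (deal xs)) ≤ length xs
  length-deal₂-≤ xs = ≤-trans (≤-reflexive (length-deal₂ xs)) (⌊n/2⌋≤n _)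

  ∈-deal⁻ : ∀ {a : A} xs → a ∈ₗ xs → a ∈ₗ proj₁ (deal xs) ⊎ a ∈ₗ proj₂ (deal xs)
  ∈-deal⁻ (x ∷ xs) (here a≡x)  = inj₁ (here a≡x)
  ∈-deal⁻ (x ∷ xs) (there a∈) with ∈-deal⁻ xs a∈
  ... | inj₁ a∈₁ = inj₂ a∈₁
  ... | inj₂ a∈₂ = inj₁ (there a∈₂)

  ∈-deal₁⁺ : ∀ {a : A} xs → a ∈ₗ proj₁ (deal xs) → a ∈ₗ xs
  ∈-deal₂⁺ : ∀ {a : A} xs → a ∈ₗ proj₂ (deal xs) → a ∈ₗ xs
  ∈-deal₁⁺ (x ∷ xs) (here a≡x) = here a≡x
  ∈-deal₁⁺ (x ∷ xs) (there a∈) = there (∈-deal₂⁺ xs a∈)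
  ∈-deal₂⁺ (x ∷ xs) a∈         = there (∈-deal₁⁺ xs a∈)

-- Matroids

module _ {n : ℕ} (M : Matroid n) where

  augment : ∀ {I J} → Indep M I → Indep M J →
            ∃[ K ] Indep M K × J ⊆ K × K ⊆ J ∪ I × ∣ I ∣ ≤ ∣ K ∣
  augment {I} {J} indI indJ = go (∣ I ∣) indJ (m≤m+n ∣ I ∣ ∣ J ∣)
    where
    go : ∀ k {J} → Indep M J → ∣ I ∣ ≤ k + ∣ J ∣ →
         ∃[ K ] Indep M K × J ⊆ K × K ⊆ J ∪ I × ∣ I ∣ ≤ ∣ K ∣
    go k {J} indJ bound with ∣ I ∣ ≤? ∣ J ∣
    ... | yes I≤J = J , indJ , id , p⊆p∪q I , I≤J
    go zero    indJ bound | no I≰J = contradiction bound I≰J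
    go (suc k) {J} indJ bound | no I≰J with indep-exch M indJ indI (≰⇒> I≰J)
    ... | x , x∈I , x∉J , indJx with go k indJx bound′
      where
      J⊂Jx : ∣ J ∣ < ∣ J ∪ ⁅ x ⁆ ∣
      J⊂Jx = p⊂q⇒∣p∣<∣q∣ (p⊆p∪q ⁅ x ⁆ , x , x∈p∪q⁺ (inj₂ (x∈⁅x⁆ x)) , x∉J)
      bound′ : ∣ I ∣ ≤ k + ∣ J ∪ ⁅ x ⁆ ∣
      bound′ = ≤-trans bound (≤-trans (≤-reflexive (sym (+-suc k _))) (+-monoʳ-≤ k J⊂Jx))
    ... | K , indK , Jx⊆K , K⊆JxI , I≤K = K , indK , Jx⊆K ∘ p⊆p∪q ⁅ x ⁆ , K⊆J∪I , I≤K
      where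
      K⊆J∪I : K ⊆ J ∪ I
      K⊆J∪I y∈K with x∈p∪q⁻ _ I (K⊆JxI y∈K)
      ... | inj₂ y∈I = x∈p∪q⁺ (inj₂ y∈I)
      ... | inj₁ y∈Jx with x∈p∪q⁻ J ⁅ x ⁆ y∈Jx
      ...   | inj₁ y∈J = x∈p∪q⁺ (inj₁ y∈J)
      ...   | inj₂ y∈x rewrite x∈⁅y⁆⇒x≡y x y∈x = x∈p∪q⁺ (inj₂ x∈I)

  -- S ∪ {y} contains at most one circuit, which lies in every dependent subset.
  single-circuit : ∀ {S y P₁ P₂} → Indep M S → P₁ ⊆ S ∪ ⁅ y ⁆ → P₂ ⊆ S ∪ ⁅ y ⁆ →
                   Indep M (P₁ ∩ P₂) → ¬ Indep M P₁ → Indep M P₂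
  single-circuit {S} {y} {P₁} {P₂} indS P₁⊆A P₂⊆A indP₁₂ depP₁ with augment indS indP₁₂
  ... | K , indK , P₁₂⊆K , K⊆P₁₂S , S≤K with ⊆⊎∃∉ P₁ K | ⊆⊎∃∉ P₂ K
  ... | inj₁ P₁⊆K | _         = contradiction (indep-down M P₁⊆K indK) depP₁
  ... | inj₂ _    | inj₁ P₂⊆K = indep-down M P₂⊆K indK
  ... | inj₂ (w₁ , w₁∈P₁ , w₁∉K) | inj₂ (w₂ , w₂∈P₂ , w₂∉K) =
    contradiction (≤-pred (≤-trans K+2≤A A≤S+1)) (≤⇒≯ S≤K)
    where
    K⊆A : K ⊆ S ∪ ⁅ y ⁆
    K⊆A z∈K with x∈p∪q⁻ (P₁ ∩ P₂) S (K⊆P₁₂S z∈K)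
    ... | inj₁ z∈P₁₂ = P₁⊆A (proj₁ (x∈p∩q⁻ P₁ P₂ z∈P₁₂))
    ... | inj₂ z∈S   = p⊆p∪q ⁅ y ⁆ z∈S
    w₁≢w₂ : w₁ ≢ w₂
    w₁≢w₂ refl = w₁∉K (P₁₂⊆K (x∈p∩q⁺ (w₁∈P₁ , w₂∈P₂)))
    K+2≤A : 2 + ∣ K ∣ ≤ ∣ S ∪ ⁅ y ⁆ ∣
    K+2≤A = ∣p∣+2≤∣q∣ K⊆A (P₁⊆A w₁∈P₁) (P₂⊆A w₂∈P₂) w₁≢w₂ w₁∉K w₂∉K
    A≤S+1 : ∣ S ∪ ⁅ y ⁆ ∣ ≤ 1 + ∣ S ∣
    A≤S+1 = ≤-trans (∣p∪q∣≤∣p∣+∣q∣ S ⁅ y ⁆) (≤-reflexive (trans (cong (∣ S ∣ +_) (∣⁅x⁆∣≡1 y)) (+-comm ∣ S ∣ 1)))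

-- Query algorithms

_>>=_ : ∀ {n A B} → QAlg n A → (A → QAlg n B) → QAlg n B
ret a     >>= k = k a
ask i X c >>= k = ask i X (λ b → c b >>= k)

module _ {n : ℕ} (M₁ M₂ : Matroid n) where

  result->>= : ∀ {A B} (m : QAlg n A) (k : A → QAlg n B) →
               result M₁ M₂ (m >>= k) ≡ result M₁ M₂ (k (result M₁ M₂ m))
  result->>= (ret a)     k = refl
  result->>= (ask i X c) k = result->>= (c (oracle M₁ M₂ i X)) k

  queries->>= : ∀ {A B} (m : QAlg n A) (k : A → QAlg n B) →
                queries M₁ M₂ (m >>= k) ≡ queries M₁ M₂ m + queries M₁ M₂ (k (result M₁ M₂ m))
  queries->>= (ret a)     k = refl
  queries->>= (ask i X c) k = cong suc (queries->>= (c (oracle M₁ M₂ i X)) k)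

-- Binary search for a single element passing a test that is queried on whole lists: as long as the
-- test holds on the current list, one query decides which half it still holds on.
module Bisection {n : ℕ} {A : Set} (i : Bool) (E : List A → Subset n) where

  bisect : ℕ → A → List A → QAlg n A
  bisect _       a []      = ret a
  bisect zero    a (_ ∷ _) = ret a
  bisect (suc k) a (b ∷ B) = ask i (E (a ∷ proj₁ (deal B))) λ front →
    if front then bisect k a (proj₁ (deal B)) else bisect k b (proj₂ (deal B))

  search : List A → QAlg n (Maybe A)
  search []      = ret nothing
  search (a ∷ B) = ask i (E (a ∷ B)) λ nonempty →
    if nonempty then bisect (length B) a B >>= (ret ∘ just) else ret nothing

  module _ (M₁ M₂ : Matroid n) where

    bisect-queries : ∀ k a B → queries M₁ M₂ (bisect k a B) ≤ ⌈log₂ length (a ∷ B) ⌉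
    bisect-queries _       a []      = z≤n
    bisect-queries zero    a (_ ∷ _) = z≤n
    bisect-queries (suc k) a (b ∷ B) =
      ≤-trans (s≤s (half (oracle M₁ M₂ i (E (a ∷ proj₁ (deal B)))))) (≤-reflexive (⌈log₂⌉-halve (length B)))
      where
      half : ∀ front → queries M₁ M₂ (if front then bisect k a (proj₁ (deal B)) else bisect k b (proj₂ (deal B)))
                       ≤ ⌈log₂ ⌈ 2 + length B /2⌉ ⌉
      half true  = ≤-trans (bisect-queries k a (proj₁ (deal B)))
                     (⌈log₂⌉-mono-≤ (s≤s (≤-reflexive (length-deal₁ B))))
      half false = ≤-trans (bisect-queries k b (proj₂ (deal B)))
                     (⌈log₂⌉-mono-≤ (s≤s (≤-trans (≤-reflexive (length-deal₂ B)) (⌊n/2⌋≤⌈n/2⌉ (length B)))))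

    search-queries : ∀ B → queries M₁ M₂ (search B) ≤ suc ⌈log₂ length B ⌉
    search-queries []      = z≤n
    search-queries (a ∷ B) with oracle M₁ M₂ i (E (a ∷ B))
    ... | true  = s≤s (begin
      queries M₁ M₂ (bisect (length B) a B >>= (ret ∘ just))
        ≡⟨ queries->>= M₁ M₂ (bisect (length B) a B) (ret ∘ just) ⟩
      queries M₁ M₂ (bisect (length B) a B) + 0
        ≤⟨ ≤-trans (≤-reflexive (+-identityʳ _)) (bisect-queries (length B) a B) ⟩
      ⌈log₂ length (a ∷ B) ⌉ ∎)
      where open ≤-Reasoning
    ... | false = s≤s z≤n

    Holds : List A → Set
    Holds B = oracle M₁ M₂ i (E B) ≡ true

    Found : List A → Maybe A → Set
    Found B (just a) = a ∈ₗ B × Holds (a ∷ [])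
    Found B nothing  = ∀ {a} → a ∈ₗ B → ¬ Holds (a ∷ [])

    module _ (split : ∀ {B B₁ B₂} → (∀ {a} → a ∈ₗ B → a ∈ₗ B₁ ⊎ a ∈ₗ B₂) →
                      Holds B → ¬ Holds B₁ → Holds B₂)
             (from-singleton : ∀ {a B} → a ∈ₗ B → Holds (a ∷ []) → Holds B) where

      bisect-holds : ∀ k a B → length B ≤ k → Holds (a ∷ B) →
                     let u = result M₁ M₂ (bisect k a B) in u ∈ₗ a ∷ B × Holds (u ∷ [])
      bisect-holds _       a []      _          holds = here refl , holds
      bisect-holds (suc k) a (b ∷ B) (s≤s len) holds with oracle M₁ M₂ i (E (a ∷ proj₁ (deal B))) in front
      ... | true with bisect-holds k a (proj₁ (deal B)) (≤-trans (length-deal₁-≤ B) len) front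
      ...   | here u≡a  , holds-u = here u≡a , holds-u
      ...   | there u∈₁ , holds-u = there (there (∈-deal₁⁺ B u∈₁)) , holds-u
      bisect-holds (suc k) a (b ∷ B) (s≤s len) holds | false
        with bisect-holds k b (proj₂ (deal B)) (≤-trans (length-deal₂-≤ B) len)
               (split cover holds λ holds-front → case trans (sym front) holds-front of λ ())
        where
        cover : ∀ {c} → c ∈ₗ a ∷ b ∷ B → c ∈ₗ a ∷ proj₁ (deal B) ⊎ c ∈ₗ b ∷ proj₂ (deal B)
        cover (here c≡a)         = inj₁ (here c≡a)
        cover (there (here c≡b)) = inj₂ (here c≡b)
        cover (there (there c∈B)) with ∈-deal⁻ B c∈B
        ... | inj₁ c∈₁ = inj₁ (there c∈₁)
        ... | inj₂ c∈₂ = inj₂ (there c∈₂)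
      ... | here u≡b  , holds-u = there (here u≡b) , holds-u
      ... | there u∈₂ , holds-u = there (there (∈-deal₂⁺ B u∈₂)) , holds-u

      search-found : ∀ B → Found B (result M₁ M₂ (search B))
      search-found []      ()
      search-found (a ∷ B) with oracle M₁ M₂ i (E (a ∷ B)) in nonempty
      ... | true rewrite result->>= M₁ M₂ (bisect (length B) a B) (ret ∘ just) =
        bisect-holds (length B) a B ≤-refl nonempty
      ... | false = λ a∈B holds-a → case trans (sym nonempty) (from-singleton a∈B holds-a) of λ ()

-- The exchange graph

module _ {n : ℕ} (M₁ M₂ : Matroid n) (S : Subset n) where

  -- PathFH M₁ M₂ S F h x xs is, by definition, x ∈ F × ToHeavy F h x xs.
  ToHeavy : Subset n → ℕ → Fin n → List (Fin n) → Set
  ToHeavy F h x xs = Walk M₁ M₂ S x xs × Unique (x ∷ xs) × Heavy M₁ M₂ S F h (lastV M₁ M₂ S x xs)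

  walk-backward : ∀ {P : Fin n → Set} → (∀ {x y} → Edge M₁ M₂ S x y → P y → P x) →
                  ∀ {x} xs → Walk M₁ M₂ S x xs → P (lastV M₁ M₂ S x xs) → P x
  walk-backward closed []       _              P-last = P-last
  walk-backward closed (y ∷ ys) (x→y , walk-y) P-last = closed x→y (walk-backward closed ys walk-y P-last)

  ∈-tabulate⁻ : ∀ {f : Fin n → Bool} {x} → x ∈ Vec.tabulate f → f x ≡ true
  ∈-tabulate⁻ {f} {x} x∈ = trans (sym (lookup∘tabulate f x)) ([]=⇒lookup x∈)

  ∈-outNbrs⁻ : ∀ {F x y} → y ∈ outNbrs M₁ M₂ S F x → y ∈ S × y ∉ F × Indep M₂ ((S - y) ∪ ⁅ x ⁆)
  ∈-outNbrs⁻ {F} {x} {y} y∈ = split (Vec.lookup S y) (Vec.lookup F y) (∈-tabulate⁻ y∈) refl refl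
    where
    split : ∀ s f → s ∧ not f ∧ indep M₂ ((S - y) ∪ ⁅ x ⁆) ≡ true →
            Vec.lookup S y ≡ s → Vec.lookup F y ≡ f → y ∈ S × y ∉ F × Indep M₂ ((S - y) ∪ ⁅ x ⁆)
    split true false ind yS yF = lookup⇒[]= y S yS , (λ y∈F → case trans (sym yF) ([]=⇒lookup y∈F) of λ ()) , ind

  ∈-outNbrs⁺ : ∀ {F x y} → y ∈ S → y ∉ F → Indep M₂ ((S - y) ∪ ⁅ x ⁆) → y ∈ outNbrs M₁ M₂ S F x
  ∈-outNbrs⁺ {F} {x} {y} y∈S y∉F ind = lookup⇒[]= y _ (trans (lookup∘tabulate _ y) conj)
    where
    conj : Vec.lookup S y ∧ not (Vec.lookup F y) ∧ indep M₂ ((S - y) ∪ ⁅ x ⁆) ≡ true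
    conj with Vec.lookup F y in yF
    ... | true  = contradiction (lookup⇒[]= y F yF) y∉F
    ... | false rewrite []=⇒lookup y∈S | ind = refl

-- For u ∈ S and y ∉ S, the set exchangeSet [ u ] is (S - u) + y, which is independent in M₁
-- exactly when (u , y) is an edge of G(S).
module InNeighbourSearch {n : ℕ} (S : Subset n) (y : Fin n) where

  exchangeSet : List (Fin n) → Subset n
  exchangeSet B = (S ─ ⟦ B ⟧) ∪ ⁅ y ⁆

  open Bisection false exchangeSet public using (search; search-queries; Found)

  ∈-exchangeSet⁻ : ∀ {z} B → z ∈ exchangeSet B → (z ∈ S × z ∉ₗ B) ⊎ z ≡ y
  ∈-exchangeSet⁻ B z∈ with x∈p∪q⁻ (S ─ ⟦ B ⟧) ⁅ y ⁆ z∈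
  ... | inj₁ z∈S─B = inj₁ (p─q⊆p S ⟦ B ⟧ z∈S─B , x∈p─q⇒x∉q S ⟦ B ⟧ z∈S─B ∘ ∈⟦⟧⁺)
  ... | inj₂ z∈y   = inj₂ (x∈⁅y⁆⇒x≡y y z∈y)

  ∈-exchangeSet⁺ : ∀ {z} B → (z ∈ S × z ∉ₗ B) ⊎ z ≡ y → z ∈ exchangeSet B
  ∈-exchangeSet⁺ B (inj₁ (z∈S , z∉B)) = x∈p∪q⁺ (inj₁ (x∈p∧x∉q⇒x∈p─q z∈S (z∉B ∘ ∈⟦⟧⁻ B)))
  ∈-exchangeSet⁺ B (inj₂ refl)        = x∈p∪q⁺ (inj₂ (x∈⁅x⁆ y))

  exchangeSet⊆S+y : ∀ B → exchangeSet B ⊆ S ∪ ⁅ y ⁆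
  exchangeSet⊆S+y B z∈ with ∈-exchangeSet⁻ B z∈
  ... | inj₁ (z∈S , _) = x∈p∪q⁺ (inj₁ z∈S)
  ... | inj₂ refl      = x∈p∪q⁺ (inj₂ (x∈⁅x⁆ y))

  exchangeSet-∩ : ∀ {B B₁ B₂} → (∀ {a} → a ∈ₗ B → a ∈ₗ B₁ ⊎ a ∈ₗ B₂) →
                  exchangeSet B₁ ∩ exchangeSet B₂ ⊆ exchangeSet B
  exchangeSet-∩ {B} {B₁} {B₂} cover z∈ with x∈p∩q⁻ (exchangeSet B₁) (exchangeSet B₂) z∈
  ... | z∈₁ , z∈₂ with ∈-exchangeSet⁻ B₁ z∈₁ | ∈-exchangeSet⁻ B₂ z∈₂
  ... | inj₂ z≡y         | _                   = ∈-exchangeSet⁺ B (inj₂ z≡y)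
  ... | inj₁ _           | inj₂ z≡y            = ∈-exchangeSet⁺ B (inj₂ z≡y)
  ... | inj₁ (z∈S , z∉₁) | inj₁ (_ , z∉₂)      = ∈-exchangeSet⁺ B (inj₁ (z∈S , λ z∈B → case cover z∈B of λ where
    (inj₁ z∈₁′) → z∉₁ z∈₁′
    (inj₂ z∈₂′) → z∉₂ z∈₂′))

  exchangeSet-antitone : ∀ {u B} → u ∈ₗ B → exchangeSet B ⊆ exchangeSet (u ∷ [])
  exchangeSet-antitone {u} {B} u∈B z∈ with ∈-exchangeSet⁻ B z∈
  ... | inj₁ (z∈S , z∉B) = ∈-exchangeSet⁺ (u ∷ []) (inj₁ (z∈S , λ { (here refl) → z∉B u∈B }))
  ... | inj₂ z≡y         = ∈-exchangeSet⁺ (u ∷ []) (inj₂ z≡y)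

  exchangeSet-[u] : ∀ u → exchangeSet (u ∷ []) ≡ (S - u) ∪ ⁅ y ⁆
  exchangeSet-[u] u = cong (λ U → (S ─ U) ∪ ⁅ y ⁆) (∪-identityʳ ⁅ u ⁆)

  module _ (M₁ M₂ : Matroid n) (indS : Indep M₁ S) where

    search-in-neighbour : ∀ B → Found M₁ M₂ B (result M₁ M₂ (search B))
    search-in-neighbour = Bisection.search-found false exchangeSet M₁ M₂
      (λ {_} {B₁} {B₂} cover indB depB₁ → single-circuit M₁ indS (exchangeSet⊆S+y B₁) (exchangeSet⊆S+y B₂)
                              (indep-down M₁ (exchangeSet-∩ cover) indB) depB₁)
      (λ u∈B → indep-down M₁ (exchangeSet-antitone u∈B))

module ReverseSearch {n : ℕ} (S F H : Subset n) (L : Fin n → Subset n) where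

  open DecMembership (_≟_ {n}) using () renaming (_∈?_ to _∈ₗ?_)

  -- An item (y , p) is a discovered vertex y with a path y ∷ p from y to a heavy vertex.
  Item : Set
  Item = Fin n × List (Fin n)

  LightInNeighbour : Fin n → Fin n → Set
  LightInNeighbour y x = x ∉ S × x ∉ F × x ∉ H × y ∈ L x

  lightInNeighbour? : ∀ y → Decidable (LightInNeighbour y)
  lightInNeighbour? y x = ¬? (x ∈? S) ×-dec ¬? (x ∈? F) ×-dec ¬? (x ∈? H) ×-dec y ∈? L x

  remaining : {P : Fin n → Set} → Decidable P → List (Fin n) → List (Fin n)
  remaining P? U = filter (∁? P?) U

  discovered : {P : Fin n → Set} → Decidable P → Item → List (Fin n) → List Item
  discovered P? (y , p) U = map (λ x → x , y ∷ p) (filter P? U)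

  candidates : List (Fin n) → List (Fin n)
  candidates U = filter (_∈ₗ? U) (elements S)

  -- U lists the undiscovered vertices and Q the queued items. A vertex y ∉ S stays at the head of
  -- the queue until the search for a further undiscovered in-neighbour of y fails.
  loop  : ℕ → List (Fin n) → List Item → QAlg n (Maybe Item)
  afterSearch : ℕ → List (Fin n) → Item → List Item → Maybe (Fin n) → QAlg n (Maybe Item)

  loop zero    U Q                = ret nothing
  loop (suc k) U []               = ret nothing
  loop (suc k) U ((y , p) ∷ Q) with y ∈? S
  ... | yes _ = loop k (remaining (lightInNeighbour? y) U) (discovered (lightInNeighbour? y) (y , p) U ++ Q)
  ... | no  _ = InNeighbourSearch.search S y (candidates U) >>= afterSearch k U (y , p) Q

  afterSearch k U it      Q nothing  = loop k U Q
  afterSearch k U (y , p) Q (just u) with u ∈? F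
  ... | yes _ = ret (just (u , y ∷ p))
  ... | no  _ = loop k (remaining (u ≟_) U) ((y , p) ∷ discovered (u ≟_) (y , p) U ++ Q)

  initialUndiscovered : List (Fin n)
  initialUndiscovered = filter (∁? (_∈? H)) (allFin n)

  initialQueue : List Item
  initialQueue = map (λ v → v , []) (filter (_∈? H) (allFin n))

  run : QAlg n (Maybe Item)
  run = loop (2 * n) initialUndiscovered initialQueue

  module _ (M₁ M₂ : Matroid n) where

    search-queries : ∀ y U → queries M₁ M₂ (InNeighbourSearch.search S y (candidates U)) ≤ suc ⌈log₂ ∣ S ∣ ⌉
    search-queries y U = ≤-trans (InNeighbourSearch.search-queries S y M₁ M₂ (candidates U))
      (s≤s (⌈log₂⌉-mono-≤ (≤-trans (length-filter (_∈ₗ? U) (elements S)) (≤-reflexive (length-elements S)))))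

    loop-queries  : ∀ k U Q → queries M₁ M₂ (loop k U Q) ≤ k * suc ⌈log₂ ∣ S ∣ ⌉
    afterSearch-queries : ∀ k U it Q r → queries M₁ M₂ (afterSearch k U it Q r) ≤ k * suc ⌈log₂ ∣ S ∣ ⌉

    loop-queries zero    U Q             = z≤n
    loop-queries (suc k) U []            = z≤n
    loop-queries (suc k) U ((y , p) ∷ Q) with y ∈? S
    ... | yes _ = ≤-trans (loop-queries k _ _) (m≤n+m _ _)
    ... | no  _ = begin
      queries M₁ M₂ (search (candidates U) >>= afterSearch k U (y , p) Q)
        ≡⟨ queries->>= M₁ M₂ (search (candidates U)) (afterSearch k U (y , p) Q) ⟩
      queries M₁ M₂ (search (candidates U)) + queries M₁ M₂ (afterSearch k U (y , p) Q r)
        ≤⟨ +-mono-≤ (search-queries y U) (afterSearch-queries k U (y , p) Q r) ⟩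
      suc k * suc ⌈log₂ ∣ S ∣ ⌉ ∎
      where
      open ≤-Reasoning
      open InNeighbourSearch S y using (search)
      r = result M₁ M₂ (search (candidates U))

    afterSearch-queries k U it      Q nothing  = loop-queries k U Q
    afterSearch-queries k U (y , p) Q (just u) with u ∈? F
    ... | yes _ = z≤n
    ... | no  _ = loop-queries k _ _

module Correctness {n : ℕ} (M₁ M₂ : Matroid n) (S : Subset n) (h : ℕ) (F H : Subset n)
                   (L : Fin n → Subset n) (indS : Indep M₁ S)
                   (noEdges : NoEdgesFbarToS M₁ M₂ S F) (heavy : HeavyInput M₁ M₂ S F h H)
                   (light : LightInput M₁ M₂ S F h L) where

  open ReverseSearch S F H L
  open InNeighbourSearch using (exchangeSet-[u])
  open DecMembership (_≟_ {n}) using () renaming (_∈?_ to _∈ₗ?_)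

  _⟶_ : Fin n → Fin n → Set
  x ⟶ y = Edge M₁ M₂ S x y

  -- Undiscovered vertices weigh 2 and queued ones 1, so discovering a vertex lowers the potential.
  potential : List (Fin n) → List Item → ℕ
  potential U Q = length Q + 2 * length U

  Reaches : List (Fin n) → Item → Set
  Reaches U (y , p) = ToHeavy M₁ M₂ S F h y p × All (_∉ₗ U) (y ∷ p)

  record Invariant (U : List (Fin n)) (Q : List Item) : Set where
    field
      undiscovered-∉H : ∀ {v} → v ∈ₗ U → v ∉ H
      discovered-∉F   : ∀ {v} → v ∉ₗ U → v ∉ F
      queued-reach    : All (Reaches U) Q
      closed          : ∀ {v} → v ∉ₗ U → v ∈ₗ map proj₁ Q ⊎ (∀ {x} → x ⟶ v → x ∉ₗ U)
  open Invariant

  module _ {P : Fin n → Set} (P? : Decidable P) where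

    ∉-remaining : ∀ {U v} → v ∉ₗ U → v ∉ₗ remaining P? U
    ∉-remaining v∉U = v∉U ∘ proj₁ ∘ ∈-filter⁻ (∁? P?)

    removed : ∀ {U v} → v ∈ₗ U → v ∉ₗ remaining P? U → P v
    removed {v = v} v∈U v∉U′ with P? v
    ... | yes Pv  = Pv
    ... | no  ¬Pv = contradiction (∈-filter⁺ (∁? P?) v∈U ¬Pv) v∉U′

    potential-discover : ∀ U it Q →
                         potential (remaining P? U) (it ∷ discovered P? it U ++ Q) + length (filter P? U)
                         ≡ potential U (it ∷ Q)
    potential-discover U it Q = begin
      suc (length (D ++ Q)) + 2 * length U′ + c
        ≡⟨ cong (λ d → suc d + 2 * length U′ + c) length-D++Q ⟩
      suc (c + length Q) + 2 * length U′ + c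
        ≡⟨ rearrange c (length Q) (length U′) ⟩
      suc (length Q) + 2 * (c + length U′)
        ≡⟨ cong (λ u → suc (length Q) + 2 * u) (length-filter+length-filter-∁ P? U) ⟩
      suc (length Q) + 2 * length U ∎
      where
      open ≡-Reasoning
      C  = filter P? U
      c  = length C
      U′ = remaining P? U
      D  = discovered P? it U
      length-D++Q : length (D ++ Q) ≡ c + length Q
      length-D++Q = trans (length-++ D) (cong (_+ length Q) (length-map _ C))
      rearrange : ∀ c q u → suc (c + q) + 2 * u + c ≡ suc q + 2 * (c + u)
      rearrange = solve-∀

    potential-discover-≤ : ∀ U it Q →
                           potential (remaining P? U) (it ∷ discovered P? it U ++ Q) ≤ potential U (it ∷ Q)
    potential-discover-≤ U it Q = ≤-trans (m≤m+n _ _) (≤-reflexive (potential-discover U it Q))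

    potential-discover-< : ∀ U it Q → Any P U →
                           potential (remaining P? U) (it ∷ discovered P? it U ++ Q) < potential U (it ∷ Q)
    potential-discover-< U it Q some = begin-strict
      potential (remaining P? U) (it ∷ discovered P? it U ++ Q)
        <⟨ m<m+n _ (filter-some P? some) ⟩
      potential (remaining P? U) (it ∷ discovered P? it U ++ Q) + length (filter P? U)
        ≡⟨ potential-discover U it Q ⟩
      potential U (it ∷ Q) ∎
      where open ≤-Reasoning

  queued-++ˡ : ∀ {v} (A : List Item) Q → v ∈ₗ map proj₁ A → v ∈ₗ map proj₁ (A ++ Q)
  queued-++ˡ A Q v∈A = subst (_ ∈ₗ_) (sym (map-++ proj₁ A Q)) (∈-++⁺ˡ v∈A)

  queued-++ʳ : ∀ {v} (A : List Item) Q → v ∈ₗ map proj₁ Q → v ∈ₗ map proj₁ (A ++ Q)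
  queued-++ʳ A Q v∈Q = subst (_ ∈ₗ_) (sym (map-++ proj₁ A Q)) (∈-++⁺ʳ (map proj₁ A) v∈Q)

  extend : ∀ {U x y p} → x ∈ₗ U → x ⟶ y → Reaches U (y , p) → ToHeavy M₁ M₂ S F h x (y ∷ p)
  extend x∈U x⟶y ((walk , unique , last-heavy) , discovered) =
    (x⟶y , walk) , (¬Any⇒All¬ _ (λ x∈ → All.lookup discovered x∈ x∈U) ∷ unique) , last-heavy

  discover : ∀ {P : Fin n → Set} (P? : Decidable P) {U y p Q} → Invariant U ((y , p) ∷ Q) →
             (∀ {x} → x ∈ₗ U → P x → x ⟶ y × x ∉ F) →
             Invariant (remaining P? U) ((y , p) ∷ discovered P? (y , p) U ++ Q)
  discover P? {U} {y} {p} {Q} inv new = record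
    { undiscovered-∉H = undiscovered-∉H inv ∘ proj₁ ∘ ∈-filter⁻ (∁? P?)
    ; discovered-∉F   = discovered-∉F′
    ; queued-reach    = monotone reach-y ∷ ++⁺ (map⁺ (All.tabulate reach-new)) (All.map monotone reach-Q)
    ; closed          = closed′
    }
    where
    U′ = remaining P? U
    reach-y = All.head (queued-reach inv)
    reach-Q = All.tail (queued-reach inv)
    monotone : ∀ {it} → Reaches U it → Reaches U′ it
    monotone (to-heavy , discovered) = to-heavy , All.map (∉-remaining P?) discovered
    reach-new : ∀ {x} → x ∈ₗ filter P? U → Reaches U′ (x , y ∷ p)
    reach-new x∈C with ∈-filter⁻ P? x∈C
    ... | x∈U , Px = extend x∈U (proj₁ (new x∈U Px)) reach-y ,
                     (λ x∈U′ → proj₂ (∈-filter⁻ (∁? P?) {xs = U} x∈U′) Px) ∷ proj₂ (monotone reach-y)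
    discovered-∉F′ : ∀ {v} → v ∉ₗ U′ → v ∉ F
    discovered-∉F′ {v} v∉U′ with v ∈ₗ? U
    ... | yes v∈U = proj₂ (new v∈U (removed P? v∈U v∉U′))
    ... | no  v∉U = discovered-∉F inv v∉U
    closed′ : ∀ {v} → v ∉ₗ U′ → v ∈ₗ map proj₁ ((y , p) ∷ discovered P? (y , p) U ++ Q) ⊎ (∀ {x} → x ⟶ v → x ∉ₗ U′)
    closed′ {v} v∉U′ with v ∈ₗ? U
    ... | yes v∈U = inj₁ (there (queued-++ˡ (discovered P? (y , p) U) Q
                     (∈-map⁺ proj₁ (∈-map⁺ _ (∈-filter⁺ P? v∈U (removed P? v∈U v∉U′))))))
    ... | no  v∉U with closed inv v∉U
    ...   | inj₁ (here v≡y)  = inj₁ (here v≡y)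
    ...   | inj₁ (there v∈Q) = inj₁ (there (queued-++ʳ (discovered P? (y , p) U) Q v∈Q))
    ...   | inj₂ closed-v    = inj₂ (∉-remaining P? ∘ closed-v)

  drop-closed : ∀ {U it Q} → Invariant U (it ∷ Q) → (∀ {x} → x ⟶ proj₁ it → x ∉ₗ U) → Invariant U Q
  drop-closed inv closed-it = record
    { undiscovered-∉H = undiscovered-∉H inv
    ; discovered-∉F   = discovered-∉F inv
    ; queued-reach    = All.tail (queued-reach inv)
    ; closed          = λ v∉U → case closed inv v∉U of λ where
        (inj₁ (here refl)) → inj₂ (λ {x} → closed-it {x})
        (inj₁ (there v∈Q)) → inj₁ v∈Q
        (inj₂ closed-v)    → inj₂ (λ {x} → closed-v {x})
    }

  heavy-discovered : ∀ {U Q v} → Invariant U Q → Heavy M₁ M₂ S F h v → v ∉ₗ U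
  heavy-discovered inv v-heavy v∈U = undiscovered-∉H inv v∈U (proj₂ (heavy _) v-heavy)

  no-path : ∀ {U} → Invariant U [] → ∀ x xs → ¬ PathFH M₁ M₂ S F h x xs
  no-path {U} inv x xs (x∈F , walk , _ , last-heavy) =
    discovered-∉F inv (walk-backward M₁ M₂ S closed-backward xs walk (heavy-discovered inv last-heavy)) x∈F
    where
    closed-backward : ∀ {x y} → x ⟶ y → y ∉ₗ U → x ∉ₗ U
    closed-backward x⟶y y∉U with closed inv y∉U
    ... | inj₂ closed-y = closed-y x⟶y

  light-vertex : ∀ {x} → x ∉ S → x ∉ F → x ∉ H → Light M₁ M₂ S F h x
  light-vertex {x} x∉S x∉F x∉H =
    x∉S , x∉F , (λ t → x∉H (proj₂ (heavy x) (x∉S , x∉F , inj₁ t))) ,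
    ≰⇒> (λ h≤ → x∉H (proj₂ (heavy x) (x∉S , x∉F , inj₂ h≤)))

  light-in-neighbour : ∀ {x y} → LightInNeighbour y x → x ⟶ y × x ∉ F
  light-in-neighbour {x} (x∉S , x∉F , x∉H , y∈Lx)
    with ∈-outNbrs⁻ M₁ M₂ S {F = F} (subst (_ ∈_) (light x (light-vertex x∉S x∉F x∉H)) y∈Lx)
  ... | y∈S , _ , ind = inj₂ (x∉S , y∈S , ind) , x∉F

  scan-closes : ∀ {U Q y} → Invariant U Q → y ∈ S → y ∉ F →
                ∀ {x} → x ⟶ y → x ∉ₗ remaining (lightInNeighbour? y) U
  scan-closes inv y∈S y∉F (inj₁ (_ , y∉S , _)) = contradiction y∈S y∉S
  scan-closes inv y∈S y∉F {x} (inj₂ (x∉S , _ , ind)) x∈U′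
    with ∈-filter⁻ (∁? (lightInNeighbour? _)) x∈U′
  ... | x∈U , not-new = not-new (x∉S , x∉F , x∉H , y∈Lx)
    where
    x∉H = undiscovered-∉H inv x∈U
    x∉F = λ x∈F → noEdges x _ x∈F x∉S y∈S y∉F (inj₂ (x∉S , y∈S , ind))
    y∈Lx = subst (_ ∈_) (sym (light x (light-vertex x∉S x∉F x∉H))) (∈-outNbrs⁺ M₁ M₂ S y∈S y∉F ind)

  Searched : Fin n → List (Fin n) → Maybe (Fin n) → Set
  Searched y U = InNeighbourSearch.Found S y M₁ M₂ (candidates U)

  searched-edge : ∀ {U y u} → y ∉ S → Searched y U (just u) → u ∈ₗ U × u ⟶ y
  searched-edge {U} {y} {u} y∉S (u∈C , ind) with ∈-filter⁻ (_∈ₗ? U) u∈C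
  ... | u∈S , u∈U = u∈U , inj₁ (∈-elements⁻ S u∈S , y∉S , subst (Indep M₁) (exchangeSet-[u] S y u) ind)

  searched-closes : ∀ {U y} → y ∉ S → Searched y U nothing → ∀ {x} → x ⟶ y → x ∉ₗ U
  searched-closes y∉S none (inj₂ (_ , y∈S , _)) = contradiction y∈S y∉S
  searched-closes {U} {y} y∉S none {x} (inj₁ (x∈S , _ , ind)) x∈U =
    none (∈-filter⁺ (_∈ₗ? U) (∈-elements⁺ x∈S) x∈U) (subst (Indep M₁) (sym (exchangeSet-[u] S y x)) ind)

  ∉initial⇒∈H : ∀ {v} → v ∉ₗ initialUndiscovered → v ∈ H
  ∉initial⇒∈H {v} v∉U₀ with v ∈? H
  ... | yes v∈H = v∈H
  ... | no  v∉H = contradiction (∈-filter⁺ (∁? (_∈? H)) (∈-allFin v) v∉H) v∉U₀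

  initial-invariant : Invariant initialUndiscovered initialQueue
  initial-invariant = record
    { undiscovered-∉H = proj₂ ∘ ∈-filter⁻ (∁? (_∈? H)) {xs = allFin n}
    ; discovered-∉F   = λ v∉U₀ → proj₁ (proj₂ (proj₁ (heavy _) (∉initial⇒∈H v∉U₀)))
    ; queued-reach    = map⁺ (All.tabulate reach)
    ; closed          = λ v∉U₀ → inj₁ (∈-map⁺ proj₁ (∈-map⁺ _ (∈-filter⁺ (_∈? H) (∈-allFin _) (∉initial⇒∈H v∉U₀))))
    }
    where
    reach : ∀ {v} → v ∈ₗ filter (_∈? H) (allFin n) → Reaches initialUndiscovered (v , [])
    reach v∈ with ∈-filter⁻ (_∈? H) {xs = allFin n} v∈
    ... | _ , v∈H = (tt , [] ∷ [] , proj₁ (heavy _) v∈H) , (λ v∈U₀ → proj₂ (∈-filter⁻ (∁? (_∈? H)) {xs = allFin n} v∈U₀) v∈H) ∷ []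

  initial-potential : potential initialUndiscovered initialQueue ≤ 2 * n
  initial-potential = begin
    length Q₀ + 2 * length U₀     ≤⟨ +-monoˡ-≤ (2 * length U₀) (m≤n*m (length Q₀) 2) ⟩
    2 * length Q₀ + 2 * length U₀ ≡⟨ sym (*-distribˡ-+ 2 (length Q₀) (length U₀)) ⟩
    2 * (length Q₀ + length U₀)   ≡⟨ cong (2 *_) Q₀+U₀≡n ⟩
    2 * n                         ∎
    where
    open ≤-Reasoning
    U₀ = initialUndiscovered
    Q₀ = initialQueue
    Q₀+U₀≡n : length Q₀ + length U₀ ≡ n
    Q₀+U₀≡n = begin-equality
      length Q₀ + length U₀                          ≡⟨ cong (_+ length U₀) (length-map _ (filter (_∈? H) (allFin n))) ⟩
      length (filter (_∈? H) (allFin n)) + length U₀ ≡⟨ length-filter+length-filter-∁ (_∈? H) (allFin n) ⟩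
      length (allFin n)                              ≡⟨ length-tabulate id ⟩
      n                                              ∎

  Output : Maybe Item → Set
  Output = CorrectOutput M₁ M₂ S F h

  -- The fuel suffices because every round decreases the potential.
  loop-correct : ∀ k U Q → Invariant U Q → potential U Q ≤ k → Output (result M₁ M₂ (loop k U Q))
  afterSearch-correct : ∀ k U y p Q r → Invariant U ((y , p) ∷ Q) → y ∉ S →
                        potential U ((y , p) ∷ Q) ≤ suc k → Searched y U r →
                        Output (result M₁ M₂ (afterSearch k U (y , p) Q r))

  loop-correct zero    U []            inv _     = no-path inv
  loop-correct (suc k) U []            inv _     = no-path inv
  loop-correct (suc k) U ((y , p) ∷ Q) inv bound with y ∈? S
  ... | yes y∈S = loop-correct k _ _
        (drop-closed (discover (lightInNeighbour? y) inv (λ _ → light-in-neighbour))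
                     (scan-closes inv y∈S y∉F))
        (≤-pred (≤-trans (potential-discover-≤ (lightInNeighbour? y) U (y , p) Q) bound))
    where
    y∉F = discovered-∉F inv (All.head (proj₂ (All.head (queued-reach inv))))
  ... | no  y∉S = subst Output (sym (result->>= M₁ M₂ (search (candidates U)) (afterSearch k U (y , p) Q)))
                    (afterSearch-correct k U y p Q _ inv y∉S bound
                      (search-in-neighbour M₁ M₂ indS (candidates U)))
    where open InNeighbourSearch S y using (search; search-in-neighbour)

  afterSearch-correct k U y p Q nothing inv y∉S bound none =
    loop-correct k U Q (drop-closed inv (searched-closes y∉S none)) (≤-pred bound)
  afterSearch-correct k U y p Q (just u) inv y∉S bound found
    with searched-edge y∉S found | u ∈? F
  ... | u∈U , u⟶y | yes u∈F = u∈F , extend u∈U u⟶y (All.head (queued-reach inv))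
  ... | u∈U , u⟶y | no  u∉F = loop-correct k _ _
        (discover (u ≟_) inv λ { _ refl → u⟶y , u∉F })
        (≤-pred (≤-trans (potential-discover-< (u ≟_) U (y , p) Q u∈U) bound))

  run-correct : Output (result M₁ M₂ run)
  run-correct = loop-correct (2 * n) _ _ initial-invariant initial-potential

lemma3p6 : ∃[ c ] Σ ((n h : ℕ) → (S F H : Subset n) → (L : Fin n → Subset n) →
                      QAlg n (Maybe (Fin n × List (Fin n)))) λ alg →
  ∀ (n : ℕ) (M₁ M₂ : Matroid n) (S : Subset n) (h : ℕ) (F H : Subset n)
    (L : Fin n → Subset n) →
  Indep M₁ S → Indep M₂ S → 1 ≤ h →
  NoEdgesFbarToS M₁ M₂ S F →
  HeavyInput M₁ M₂ S F h H →
  LightInput M₁ M₂ S F h L →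
  (queries M₁ M₂ (alg n h S F H L) ≤ c * n * suc ⌈log₂ ∣ S ∣ ⌉)
  × CorrectOutput M₁ M₂ S F h (result M₁ M₂ (alg n h S F H L))
lemma3p6 = 2 , (λ n h S F H L → ReverseSearch.run S F H L) ,
  λ n M₁ M₂ S h F H L indS _ _ noEdges heavy light →
    ReverseSearch.loop-queries S F H L M₁ M₂ (2 * n) _ _ ,
    Correctness.run-correct M₁ M₂ S h F H L indS noEdges heavy light
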